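{- Let $T$ be a tree with $n=|V(T)|$ vertices and let $k$ be an integer with $2\leq k\leq n-1$. Then $$ Sz_{k}(T)=\sum_{e=uv\in E(T)} \left({n_u(e)-1 \choose k-1}+1\right)\left({n_v(e)-1\choose k-1}+ 1\right). $$
   Context: For a connected graph $G$ and $S\subseteq V(G)$, the Steiner distance $d_G(S)$ is the minimum number of edges of a connected subgraph (equivalently, a subtree) of $G$ whose vertex set contains $S$. For an edge $e=uv$ of $G$, $n_u(e)$ denotes the number of vertices $w$ of $G$ with $d_G(w,u)<d_G(w,v)$ (for a tree, this is the number of vertices of the component of $T-e$ containing $u$), and $n_v(e)$ is defined symmetrically. For a positive integer $k$, define $N_u(e;k)=\{S'\subseteq V(G)\setminus\{u,v\} : |S'|=k-1,\ d_G(S'\cup\{u\})<d_G(S'\cup\{v\})\}$, $N_v(e;k)=\{S'\subseteq V(G)\setminus\{u,v\} : |S'|=k-1,\ d_G(S'\cup\{v\})<d_G(S'\cup\{u\})\}$, and $n_u(e;k)=|N_u(e;k)|$, $n_v(e;k)=|N_v(e;k)|$. The $k$th Steiner Szeged index is $Sz_k(G)=\sum_{e=uv\in E(G)}(n_u(e;k)+1)(n_v(e;k)+1)$. -}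

module Defs where

open import Data.Nat using (ℕ; zero; suc; _+_; _*_; _∸_; _≤_; _<_; _<?_; _≟_)
open import Data.Nat.Combinatorics using (_C_)
open import Data.Bool using (Bool; true; false; T)
open import Data.Fin using (Fin; toℕ)
open import Data.Fin.Subset using (Subset; _∈_; _∉_; _∪_; ⁅_⁆; ∣_∣)
open import Data.Fin.Subset.Properties using (_∈?_)
open import Data.List using (List; []; _∷_; _++_; [_]; length; filter; map; concatMap; allFin)
open import Data.Nat.ListAction using (sum)
open import Data.List.Membership.Propositional using () renaming (_∈_ to _∈ₗ_)
open import Data.List.Relation.Unary.All using (All)
open import Data.List.Relation.Unary.Unique.Propositional using (Unique)
open import Data.Vec using (Vec; []; _∷_)
open import Data.Product using (_×_; _,_; Σ; ∃; ∃-syntax; proj₁; proj₂)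
open import Data.Sum using (_⊎_)
open import Relation.Binary.PropositionalEquality using (_≡_)
open import Relation.Nullary using (¬_; Dec; yes; no)
open import Relation.Nullary.Decidable using (_×-dec_; ¬?)

record Graph (n : ℕ) : Set where
  field
    adj   : Fin n → Fin n → Bool
    sym   : ∀ x y → adj x y ≡ adj y x
    irrefl : ∀ x → adj x x ≡ false

open Graph public

Adj : ∀ {n} → Graph n → Fin n → Fin n → Set
Adj G x y = T (adj G x y)

data Walk {n : ℕ} (R : Fin n → Fin n → Set) : Fin n → Fin n → ℕ → Set where
  here : ∀ {x} → Walk R x x 0
  step : ∀ {x y z m} → R x y → Walk R y z m → Walk R x z (suc m)

data Chain {n : ℕ} (R : Fin n → Fin n → Set) : List (Fin n) → Set where
  []  : Chain R []
  [-] : ∀ {x} → Chain R (x ∷ [])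
  _∷_ : ∀ {x y xs} → R x y → Chain R (y ∷ xs) → Chain R (x ∷ y ∷ xs)

Connected : ∀ {n} → Graph n → Set
Connected G = ∀ x y → ∃[ m ] Walk (Adj G) x y m

HasCycle : ∀ {n} → Graph n → Set
HasCycle {n} G = Σ (Fin n) λ v → Σ (List (Fin n)) λ vs →
  (3 ≤ length (v ∷ vs)) × Unique (v ∷ vs) × Chain (Adj G) ((v ∷ vs) ++ [ v ])

IsTree : ∀ {n} → Graph n → Set
IsTree G = Connected G × ¬ HasCycle G

edges : ∀ {n} → Graph n → List (Fin n × Fin n)
edges {n} G = concatMap (λ u → map (λ v → (u , v))
                 (filter (λ v → toℕ u <? toℕ v ×-dec T? (adj G u v)) (allFin n)))
              (allFin n)
  where
  T? : (b : Bool) → Dec (T b)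
  T? true  = yes _
  T? false = no (λ ())

record Subgraph {n : ℕ} (G : Graph n) : Set where
  field
    W       : Subset n
    F       : List (Fin n × Fin n)
    F-uniq  : Unique F
    F-edges : All (λ e → (toℕ (proj₁ e) < toℕ (proj₂ e)) × Adj G (proj₁ e) (proj₂ e)
                          × proj₁ e ∈ W × proj₂ e ∈ W) F

open Subgraph public

SubAdj : ∀ {n} {G : Graph n} → Subgraph G → Fin n → Fin n → Set
SubAdj H x y = ((x , y) ∈ₗ F H) ⊎ ((y , x) ∈ₗ F H)

SubConnected : ∀ {n} {G : Graph n} → Subgraph G → Set
SubConnected H = ∀ x y → x ∈ W H → y ∈ W H → ∃[ m ] Walk (SubAdj H) x y m

_⊆ₛ_ : ∀ {n} → Subset n → Subset n → Set
S ⊆ₛ W = ∀ x → x ∈ S → x ∈ W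

IsSteinerDist : ∀ {n} → Graph n → Subset n → ℕ → Set
IsSteinerDist G S d =
  (Σ (Subgraph G) λ H → SubConnected H × S ⊆ₛ W H × length (F H) ≡ d)
  × (∀ (H : Subgraph G) → SubConnected H → S ⊆ₛ W H → d ≤ length (F H))

IsDist : ∀ {n} → Graph n → Fin n → Fin n → ℕ → Set
IsDist G x y d = Walk (Adj G) x y d × (∀ m → Walk (Adj G) x y m → d ≤ m)

allSubsets : ∀ n → List (Subset n)
allSubsets zero    = [] ∷ []
allSubsets (suc n) = map (true ∷_) (allSubsets n) ++ map (false ∷_) (allSubsets n)

count : ∀ {A : Set} {P : A → Set} → (∀ x → Dec (P x)) → List A → ℕ
count P? xs = length (filter P? xs)

nVert : ∀ {n} → (Fin n → Fin n → ℕ) → Fin n → Fin n → ℕ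
nVert {n} dist u v = count (λ w → dist w u <? dist w v) (allFin n)

nSteiner : ∀ {n} → (Subset n → ℕ) → ℕ → Fin n → Fin n → ℕ
nSteiner {n} sd k u v = count P? (allSubsets n)
  where
  P? : ∀ S' → Dec ((u ∉ S') × (v ∉ S') × (∣ S' ∣ ≡ k ∸ 1)
                    × (sd (S' ∪ ⁅ u ⁆) < sd (S' ∪ ⁅ v ⁆)))
  P? S' = ¬? (u ∈? S') ×-dec ¬? (v ∈? S') ×-dec (∣ S' ∣ ≟ k ∸ 1)
          ×-dec (sd (S' ∪ ⁅ u ⁆) <? sd (S' ∪ ⁅ v ⁆))

SzSteiner : ∀ {n} → Graph n → (Subset n → ℕ) → ℕ → ℕ
SzSteiner G sd k = sum (map (λ e → (nSteiner sd k (proj₁ e) (proj₂ e) + 1)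
                                  * (nSteiner sd k (proj₂ e) (proj₁ e) + 1)) (edges G))

SzFormula : ∀ {n} → Graph n → (Fin n → Fin n → ℕ) → ℕ → ℕ
SzFormula G dist k = sum (map (λ e →
    (((nVert dist (proj₁ e) (proj₂ e) ∸ 1) C (k ∸ 1)) + 1)
  * (((nVert dist (proj₂ e) (proj₁ e) ∸ 1) C (k ∸ 1)) + 1)) (edges G))

module Submission where

-- In an acyclic graph the vertices closer to u than to v form a side of the edge uv that only uv
-- leaves: a second edge xy leaving it would, together with geodesics from x to u and from v to y,
-- close a non-backtracking walk and hence a cycle.  So a connected subgraph containing S ∪ {v}
-- with S ≠ ∅ on u's side must use uv, and cutting it back to u's side gives a strictly smaller
-- one containing S ∪ {u}; if instead S meets v's side, an optimal subgraph for S ∪ {u} already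
-- contains v.  For k ≥ 2 the sets counted by n_u(e;k) are therefore exactly the (k−1)-subsets of
-- u's side minus u, of which there are C(n_u(e) − 1, k − 1).

open import Defs
open import Data.Nat using (ℕ; _≤_; _∸_)
open import Data.Fin using (Fin)
open import Data.Fin.Subset using (Subset)
open import Relation.Binary.PropositionalEquality using (_≡_)

open import Data.Nat using (zero; suc; _+_; _*_; _<_; _<?_; _≟_; z≤n; s≤s)
open import Data.Nat.Properties
  using (module ≤-Reasoning; ≤-trans; <⇒≤; <-≤-trans; ≤-pred; <⇒≱; ≮⇒≥; 1+n≰n; n≤1+n; n≮0; n≤0⇒n≡0; m+1+n≢0; suc-injective; 1+n≢0)
open import Data.Nat.Combinatorics using (_C_; nCk+nC[k+1]≡[n+1]C[k+1])
import Data.Fin.Properties as Fin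
open import Data.Fin.Subset
  using (_∈_; _∉_; _⊆_; _∪_; _∩_; _─_; _-_; ⁅_⁆; ∣_∣; inside; outside; Nonempty)
open import Data.Fin.Subset.Properties
  using (_⊆?_; drop-there; drop-∷-⊆; in⊆in; out⊆; p─⊥≡p; p─q⊆p; x∈p∧x≢y⇒x∈p-y;
         x∈p∪q⁺; x∈p∪q⁻; x∈⁅x⁆; x∈⁅y⁆⇒x≡y; x∈p∩q⁺; x∈p∩q⁻)
open import Data.Bool using (T)
import Data.Vec as Vec
open import Data.Vec using ([]; _∷_; here; there)
open import Data.Vec.Properties using (lookup∘tabulate; []=⇒lookup; lookup⇒[]=)
open import Data.List using (List; []; _∷_; _++_; [_]; length; filter; map; allFin; tabulate)
open import Data.List.Properties using (filter-≐; filter-++; filter-none; filter-notAll; length-++; map-cong-local)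
open import Data.List.Membership.Propositional using () renaming (_∈_ to _∈ₗ_)
open import Data.List.Membership.Propositional.Properties using (∈-filter⁺; ∈-∃++)
open import Data.List.Relation.Unary.Any using (Any; here; there)
import Data.List.Relation.Unary.Any as Any
open import Data.List.Relation.Unary.All using (All; []; _∷_)
import Data.List.Relation.Unary.All as All
import Data.List.Relation.Unary.All.Properties as All
open import Data.List.Relation.Unary.AllPairs using (allPairs?; []; _∷_)
open import Data.List.Relation.Unary.Unique.Propositional using (Unique)
import Data.List.Relation.Unary.Unique.Propositional.Properties as Unique
open import Data.Nat.ListAction using (sum)
import Data.Product as Product
open import Data.Product using (_×_; _,_; ∃-syntax; proj₁; proj₂)
import Data.Sum as Sum
open import Data.Sum using (_⊎_; inj₁; inj₂)
open import Data.Unit using (⊤; tt)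
open import Function using (_∘_; id)
open import Relation.Binary.PropositionalEquality
  using (refl; cong; cong₂; subst; trans; _≢_; module ≡-Reasoning) renaming (sym to ≡-sym)
open import Relation.Nullary using (¬_; yes; no; does; contradiction)
open import Relation.Nullary.Decidable using (_×-dec_; ¬?; dec-true)
open import Relation.Unary using (Decidable; _≐_)

-- Counting subsets

module _ {A : Set} {P : A → Set} (P? : Decidable P) where

  count-++ : ∀ xs ys → count P? (xs ++ ys) ≡ count P? xs + count P? ys
  count-++ xs ys = trans (cong length (filter-++ P? xs ys)) (length-++ (filter P? xs))

  count-none : (∀ x → ¬ P x) → ∀ xs → count P? xs ≡ 0
  count-none ¬P xs = cong length (filter-none P? (All.universal ¬P xs))

  count-map : ∀ {B : Set} (f : B → A) xs → count P? (map f xs) ≡ count (P? ∘ f) xs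
  count-map f [] = refl
  count-map f (x ∷ xs) with P? (f x)
  ... | yes _ = cong suc (count-map f xs)
  ... | no _ = count-map f xs

count-≐ : ∀ {A : Set} {P Q : A → Set} (P? : Decidable P) (Q? : Decidable Q) →
          P ≐ Q → ∀ xs → count P? xs ≡ count Q? xs
count-≐ P? Q? P≐Q xs = cong length (filter-≐ P? Q? P≐Q xs)

⟦_⟧ : ∀ {n} {P : Fin n → Set} → Decidable P → Subset n
⟦ P? ⟧ = Vec.tabulate (does ∘ P?)

module _ {n} {P : Fin n → Set} (P? : Decidable P) where

  ∈⟦⟧⁺ : ∀ {x} → P x → x ∈ ⟦ P? ⟧
  ∈⟦⟧⁺ {x} Px = lookup⇒[]= x ⟦ P? ⟧ (trans (lookup∘tabulate _ x) (dec-true (P? x) Px))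

  ∈⟦⟧⁻ : ∀ {x} → x ∈ ⟦ P? ⟧ → P x
  -- The second abstraction turns the no-case equation into false ≡ true.
  ∈⟦⟧⁻ {x} x∈ with P? x | trans (≡-sym (lookup∘tabulate (does ∘ P?) x)) ([]=⇒lookup x∈)
  ... | yes Px | _ = Px

∣⟦⟧∣≡count : ∀ {n} {P : Fin n → Set} (P? : Decidable P) → ∣ ⟦ P? ⟧ ∣ ≡ count P? (allFin n)
∣⟦⟧∣≡count {n} P? = go id
  where
  go : ∀ {m} (f : Fin m → Fin n) → ∣ Vec.tabulate (does ∘ P? ∘ f) ∣ ≡ count P? (tabulate f)
  go {zero} f = refl
  go {suc m} f with P? (f Fin.zero)
  ... | yes _ = cong suc (go (f ∘ Fin.suc))
  ... | no _ = go (f ∘ Fin.suc)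

x∈p─q⇒x∉q : ∀ {n} {p q : Subset n} {x} → x ∈ p ─ q → x ∉ q
x∈p─q⇒x∉q {p = _ ∷ _} {outside ∷ _} here ()
x∈p─q⇒x∉q {p = _ ∷ _} {_ ∷ _} (there x∈p─q) x∈q = x∈p─q⇒x∉q x∈p─q (drop-there x∈q)

suc∣p-x∣≡∣p∣ : ∀ {n} {p : Subset n} {x} → x ∈ p → suc ∣ p - x ∣ ≡ ∣ p ∣
suc∣p-x∣≡∣p∣ {p = inside ∷ p} here = cong (suc ∘ ∣_∣) (p─⊥≡p p)
suc∣p-x∣≡∣p∣ {p = inside ∷ p} (there x∈p) = cong suc (suc∣p-x∣≡∣p∣ x∈p)
suc∣p-x∣≡∣p∣ {p = outside ∷ p} (there x∈p) = suc∣p-x∣≡∣p∣ x∈p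

∣p∣≡1+m⇒nonempty : ∀ {n m} (p : Subset n) → ∣ p ∣ ≡ suc m → Nonempty p
∣p∣≡1+m⇒nonempty (inside ∷ p) _ = Fin.zero , here
∣p∣≡1+m⇒nonempty (outside ∷ p) ∣p∣≡1+m = Product.map Fin.suc there (∣p∣≡1+m⇒nonempty p ∣p∣≡1+m)

SizedSubsetOf : ∀ {m} → Subset m → ℕ → Subset m → Set
SizedSubsetOf B j S = S ⊆ B × ∣ S ∣ ≡ j

sizedSubsetOf? : ∀ {m} (B : Subset m) j → Decidable (SizedSubsetOf B j)
sizedSubsetOf? B j S = S ⊆? B ×-dec ∣ S ∣ ≟ j

count-sizedSubsets : ∀ {m} (B : Subset m) j → count (sizedSubsetOf? B j) (allSubsets m) ≡ ∣ B ∣ C j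
count-sizedSubsets [] zero = refl
count-sizedSubsets [] (suc j) = refl
count-sizedSubsets {suc m} (b ∷ B) j = begin
    count P? (map (inside ∷_) L ++ map (outside ∷_) L)
  ≡⟨ count-++ P? (map (inside ∷_) L) (map (outside ∷_) L) ⟩
    count P? (map (inside ∷_) L) + count P? (map (outside ∷_) L)
  ≡⟨ cong₂ _+_ (count-map P? (inside ∷_) L) (count-map P? (outside ∷_) L) ⟩
    count (P? ∘ (inside ∷_)) L + count (P? ∘ (outside ∷_)) L
  ≡⟨ cong (count (P? ∘ (inside ∷_)) L +_) (count-≐ _ _ (Product.map₁ drop-∷-⊆ , Product.map₁ out⊆) L) ⟩
    count (P? ∘ (inside ∷_)) L + count (sizedSubsetOf? B j) L
  ≡⟨ cong (count (P? ∘ (inside ∷_)) L +_) (count-sizedSubsets B j) ⟩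
    count (P? ∘ (inside ∷_)) L + ∣ B ∣ C j
  ≡⟨ pascal b j ⟩
    ∣ b ∷ B ∣ C j
  ∎
  where
  open ≡-Reasoning
  L : List (Subset m)
  L = allSubsets m
  P? : Decidable (SizedSubsetOf (b ∷ B) j)
  P? = sizedSubsetOf? (b ∷ B) j

  pascal : ∀ b j → count (sizedSubsetOf? (b ∷ B) j ∘ (inside ∷_)) L + ∣ B ∣ C j ≡ ∣ b ∷ B ∣ C j
  pascal outside j =
    cong (_+ ∣ B ∣ C j) (count-none _ (λ S (⊆ , _) → contradiction (⊆ here) λ ()) L)
  pascal inside zero =
    cong (_+ ∣ B ∣ C 0) (count-none _ (λ S (_ , ∣S∣≡0) → 1+n≢0 ∣S∣≡0) L)
  pascal inside (suc j) = begin
      count (sizedSubsetOf? (inside ∷ B) (suc j) ∘ (inside ∷_)) L + ∣ B ∣ C suc j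
    ≡⟨ cong (_+ ∣ B ∣ C suc j) (count-≐ _ _ (Product.map drop-∷-⊆ suc-injective , Product.map in⊆in (cong suc)) L) ⟩
      count (sizedSubsetOf? B j) L + ∣ B ∣ C suc j
    ≡⟨ cong (_+ ∣ B ∣ C suc j) (count-sizedSubsets B j) ⟩
      ∣ B ∣ C j + ∣ B ∣ C suc j
    ≡⟨ nCk+nC[k+1]≡[n+1]C[k+1] ∣ B ∣ j ⟩
      suc ∣ B ∣ C suc j
    ∎

-- Non-backtracking walks

NoReturn : ∀ {A : Set} → List A → Set
NoReturn (a ∷ b ∷ c ∷ xs) = a ≢ c × NoReturn (b ∷ c ∷ xs)
NoReturn _ = ⊤

NoReturn-tail : ∀ {A : Set} {x : A} xs → NoReturn (x ∷ xs) → NoReturn xs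
NoReturn-tail [] _ = tt
NoReturn-tail (_ ∷ []) _ = tt
NoReturn-tail (_ ∷ _ ∷ _) (_ , nr) = nr

Chain-tail : ∀ {n} {R : Fin n → Fin n → Set} {x xs} → Chain R (x ∷ xs) → Chain R xs
Chain-tail [-] = []
Chain-tail (_ ∷ c) = c

Chain-prefix : ∀ {n} {R : Fin n → Fin n → Set} xs {y ys} → Chain R (xs ++ y ∷ ys) → Chain R (xs ++ [ y ])
Chain-prefix [] _ = [-]
Chain-prefix (_ ∷ []) (r ∷ _) = r ∷ [-]
Chain-prefix (_ ∷ x ∷ xs) (r ∷ c) = r ∷ Chain-prefix (x ∷ xs) c

Unique-prefix : ∀ {A : Set} (xs : List A) {ys} → Unique (xs ++ ys) → Unique xs
Unique-prefix [] _ = []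
Unique-prefix (_ ∷ xs) (x∉ ∷ u) = All.++⁻ˡ xs x∉ ∷ Unique-prefix xs u

Unique-++-∷⇒∉ : ∀ {A : Set} (xs : List A) {z ys} → Unique (xs ++ z ∷ ys) → All (z ≢_) xs
Unique-++-∷⇒∉ [] _ = []
Unique-++-∷⇒∉ (_ ∷ xs) (x∉ ∷ u) =
  (λ { refl → All.head (All.++⁻ʳ xs x∉) refl }) ∷ Unique-++-∷⇒∉ xs u

module Walks {n : ℕ} (R : Fin n → Fin n → Set) (R-sym : ∀ {x y} → R x y → R y x) where

  infixr 5 _++ʷ_

  _++ʷ_ : ∀ {x y z m m′} → Walk R x y m → Walk R y z m′ → Walk R x z (m + m′)
  here ++ʷ w′ = w′
  step r w ++ʷ w′ = step r (w ++ʷ w′)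

  _∷ʳʷ_ : ∀ {x y z m} → Walk R x y m → R y z → Walk R x z (suc m)
  here ∷ʳʷ r = step r here
  step r′ w ∷ʳʷ r = step r′ (w ∷ʳʷ r)

  reverse : ∀ {x y m} → Walk R x y m → Walk R y x m
  reverse here = here
  reverse (step r w) = reverse w ∷ʳʷ R-sym r

  vertices : ∀ {x y m} → Walk R x y m → List (Fin n)
  vertices (here {x}) = [ x ]
  vertices (step {x} _ w) = x ∷ vertices w

  vertices-chain : ∀ {x y m} (w : Walk R x y m) → Chain R (vertices w)
  vertices-chain here = [-]
  vertices-chain (step r here) = r ∷ [-]
  vertices-chain (step r (step r′ w)) = r ∷ vertices-chain (step r′ w)

  end∈vertices : ∀ {x y m} (w : Walk R x y m) → y ∈ₗ vertices w
  end∈vertices here = here refl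
  end∈vertices (step _ w) = there (end∈vertices w)

  closed⇒¬unique : ∀ {x m} (w : Walk R x x m) → m ≢ 0 → ¬ Unique (vertices w)
  closed⇒¬unique here m≢0 _ = m≢0 refl
  closed⇒¬unique (step _ w) _ (x∉ ∷ _) = All.lookup x∉ (end∈vertices w) refl

  DistAtLeast : ℕ → Fin n → Fin n → Set
  DistAtLeast m x y = ∀ {m′} → Walk R x y m′ → m ≤ m′

  NonBacktracking : ∀ {x y m} → Walk R x y m → Set
  NonBacktracking here = ⊤
  NonBacktracking (step _ here) = ⊤
  NonBacktracking (step {x} _ (step {y = z} r w)) = x ≢ z × NonBacktracking (step r w)

  NotEnteredFrom : Fin n → ∀ {x y m} → Walk R x y m → Set
  NotEnteredFrom t here = ⊤
  NotEnteredFrom t (step {x} _ here) = x ≢ t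
  NotEnteredFrom t (step _ (step r w)) = NotEnteredFrom t (step r w)

  shortest⇒nonBacktracking : ∀ {x y m} (w : Walk R x y m) → DistAtLeast m x y → NonBacktracking w
  shortest⇒nonBacktracking here _ = tt
  shortest⇒nonBacktracking (step _ here) _ = tt
  shortest⇒nonBacktracking (step r (step r′ w)) shortest =
      (λ { refl → 1+n≰n (≤-trans (n≤1+n _) (shortest w)) })
    , shortest⇒nonBacktracking (step r′ w) (≤-pred ∘ shortest ∘ step r)

  shortest⇒notEnteredFrom : ∀ {s y t m} (w : Walk R s y m) → DistAtLeast m s t → NotEnteredFrom t w
  shortest⇒notEnteredFrom here _ = tt
  shortest⇒notEnteredFrom (step _ here) shortest = λ { refl → 1+n≰n (shortest here) }
  shortest⇒notEnteredFrom (step r (step r′ w)) shortest =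
    shortest⇒notEnteredFrom (step r′ w) (≤-pred ∘ shortest ∘ step r)

  step-nonBacktracking : ∀ {y x t m} (r : R y x) (w : Walk R x t m) →
    NonBacktracking w → DistAtLeast m y t → NonBacktracking (step r w)
  step-nonBacktracking r here _ _ = tt
  step-nonBacktracking r (step _ w) nb far = (λ { refl → 1+n≰n (far w) }) , nb

  step-notEnteredFrom : ∀ {y x u v m} (r : R y x) (w : Walk R x u m) →
    (x ≡ u → y ≢ v) → DistAtLeast m x v → NotEnteredFrom v (step r w)
  step-notEnteredFrom r here y≢v _ = y≢v refl
  step-notEnteredFrom r (step r′ w) _ far = shortest⇒notEnteredFrom (step r′ w) far

  ++-nonBacktracking : ∀ {s y x t m m′} (w : Walk R s y m) (r : R y x) (w′ : Walk R x t m′) →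
    NonBacktracking w → NonBacktracking (step r w′) → NotEnteredFrom x w →
    NonBacktracking (w ++ʷ step r w′)
  ++-nonBacktracking here _ _ _ nb′ _ = nb′
  ++-nonBacktracking (step _ here) _ _ _ nb′ x≢ = x≢ , nb′
  ++-nonBacktracking (step _ (step r w)) r′ w′ (x≢ , nb) nb′ ne =
    x≢ , ++-nonBacktracking (step r w) r′ w′ nb nb′ ne

  nonBacktracking⇒noReturn : ∀ {x y m} (w : Walk R x y m) → NonBacktracking w → NoReturn (vertices w)
  nonBacktracking⇒noReturn here _ = tt
  nonBacktracking⇒noReturn (step _ here) _ = tt
  nonBacktracking⇒noReturn (step _ (step _ here)) (x≢ , _) = x≢ , tt
  nonBacktracking⇒noReturn (step _ (step r (step r′ w))) (x≢ , nb) =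
    x≢ , nonBacktracking⇒noReturn (step r (step r′ w)) nb

module _ {n : ℕ} (G : Graph n) where

  adj-sym : ∀ {x y} → Adj G x y → Adj G y x
  adj-sym {x} {y} = subst T (sym G x y)

  adj-irrefl : ∀ {x} → ¬ Adj G x x
  adj-irrefl {x} = subst T (irrefl G x)

module _ {n : ℕ} {G : Graph n} (H : Subgraph G) where

  ∈F⇒adj×∈W : ∀ {a b} → (a , b) ∈ₗ F H → Adj G a b × a ∈ W H × b ∈ W H
  ∈F⇒adj×∈W = proj₂ ∘ All.lookup (F-edges H)

  subAdj⇒adj : ∀ {a b} → SubAdj H a b → Adj G a b
  subAdj⇒adj (inj₁ ab∈) = proj₁ (∈F⇒adj×∈W ab∈)
  subAdj⇒adj (inj₂ ba∈) = adj-sym G (proj₁ (∈F⇒adj×∈W ba∈))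

  subAdj⇒∈W : ∀ {a b} → SubAdj H a b → a ∈ W H × b ∈ W H
  subAdj⇒∈W (inj₁ ab∈) = proj₂ (∈F⇒adj×∈W ab∈)
  subAdj⇒∈W (inj₂ ba∈) = Product.swap (proj₂ (∈F⇒adj×∈W ba∈))

⊆ₛ-∪⁅⁆ : ∀ {n} {S W : Subset n} {x} → S ⊆ₛ W → x ∈ W → (S ∪ ⁅ x ⁆) ⊆ₛ W
⊆ₛ-∪⁅⁆ {S = S} S⊆W x∈W y y∈ with x∈p∪q⁻ S _ y∈
... | inj₁ y∈S = S⊆W y y∈S
... | inj₂ y∈⁅x⁆ rewrite x∈⁅y⁆⇒x≡y _ y∈⁅x⁆ = x∈W

⊆ₛ-∪⁅⁆⁻ : ∀ {n} {S W : Subset n} {x} → (S ∪ ⁅ x ⁆) ⊆ₛ W → S ⊆ₛ W × x ∈ W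
⊆ₛ-∪⁅⁆⁻ {x = x} S∪x⊆W = (λ y y∈S → S∪x⊆W y (x∈p∪q⁺ (inj₁ y∈S))) , S∪x⊆W x (x∈p∪q⁺ (inj₂ (x∈⁅x⁆ x)))

module Cycles {n : ℕ} (G : Graph n) where

  open Walks (Adj G) (adj-sym G)

  returning-chain⇒length≥3 : ∀ {z} xs {ys} → Chain (Adj G) (z ∷ xs ++ z ∷ ys) → NoReturn (z ∷ xs ++ z ∷ ys) →
    3 ≤ length (z ∷ xs)
  returning-chain⇒length≥3 [] (zz ∷ _) _ = contradiction zz (adj-irrefl G)
  returning-chain⇒length≥3 (_ ∷ []) _ (z≢z , _) = contradiction refl z≢z
  returning-chain⇒length≥3 (_ ∷ _ ∷ _) _ _ = s≤s (s≤s (s≤s z≤n))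

  -- The last suffix that is not duplicate-free closes a cycle at its first vertex.
  repeating-chain⇒cycle : ∀ xs → Chain (Adj G) xs → NoReturn xs → ¬ Unique xs → HasCycle G
  repeating-chain⇒cycle [] _ _ ¬u = contradiction [] ¬u
  repeating-chain⇒cycle (z ∷ xs) c nr ¬u with allPairs? (λ x y → ¬? (x Fin.≟ y)) xs
  ... | no ¬u′ = repeating-chain⇒cycle xs (Chain-tail c) (NoReturn-tail xs nr) ¬u′
  ... | yes u′ with Any.any? (z Fin.≟_) xs
  ...   | no z∉ = contradiction (All.¬Any⇒All¬ xs z∉ ∷ u′) ¬u
  ...   | yes z∈ with ∈-∃++ z∈
  ...     | ys , zs , refl =
    z , ys , returning-chain⇒length≥3 ys c nr
      , (Unique-++-∷⇒∉ ys u′ ∷ Unique-prefix ys u′) , Chain-prefix (z ∷ ys) c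

  closed-nonBacktracking⇒cycle : ∀ {x m} (w : Walk (Adj G) x x m) → m ≢ 0 → NonBacktracking w → HasCycle G
  closed-nonBacktracking⇒cycle w m≢0 nb =
    repeating-chain⇒cycle (vertices w) (vertices-chain w) (nonBacktracking⇒noReturn w nb) (closed⇒¬unique w m≢0)

-- The two sides of an edge of an acyclic graph

module Sides {n : ℕ} (G : Graph n) (acyclic : ¬ HasCycle G)
  (dist : Fin n → Fin n → ℕ) (dist-ok : ∀ x y → IsDist G x y (dist x y)) where

  open Cycles G
  open Walks (Adj G) (adj-sym G)

  geodesic : ∀ x y → Walk (Adj G) x y (dist x y)
  geodesic x y = proj₁ (dist-ok x y)

  dist-min : ∀ x y → DistAtLeast (dist x y) x y
  dist-min x y w = proj₂ (dist-ok x y) _ w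

  Closer : Fin n → Fin n → Fin n → Set
  Closer u v w = dist w u < dist w v

  closer? : ∀ u v → Decidable (Closer u v)
  closer? u v w = dist w u <? dist w v

  dist-refl : ∀ x → dist x x ≡ 0
  dist-refl x = n≤0⇒n≡0 (dist-min x x here)

  closer-self : ∀ {u v} → Adj G u v → Closer u v u
  closer-self {u} {v} uv rewrite dist-refl u with dist u v | geodesic u v
  ... | zero | here = contradiction uv (adj-irrefl G)
  ... | suc _ | _ = s≤s z≤n

  ¬closer-other : ∀ u v → ¬ Closer u v v
  ¬closer-other u v rewrite dist-refl v = n≮0

  -- With a = d(x,u) and b = d(y,v): b ≤ d(y,u) ≤ a + 1 ≤ d(x,v) ≤ b + 1, and these bounds
  -- rule out a backtrack at each junction of the closed walk v ⇝ y → x ⇝ u → v.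
  crossing-closes-cycle : ∀ {u v x y} → Adj G u v → Adj G x y → Closer u v x → ¬ Closer u v y →
    (x ≡ u → y ≢ v) → HasCycle G
  crossing-closes-cycle {u} {v} {x} {y} uv xy x-closer y-farther xy≢uv =
    closed-nonBacktracking⇒cycle (v⇝y ++ʷ step yx (x⇝u ++ʷ step uv here)) (m+1+n≢0 _)
      (++-nonBacktracking v⇝y yx _ v⇝y-nb
        (++-nonBacktracking (step yx x⇝u) uv here y⇝u-nb tt y⇝u-not-from-v)
        v⇝y-not-from-x)
    where
    yx : Adj G y x
    yx = adj-sym G xy
    x⇝u : Walk (Adj G) x u (dist x u)
    x⇝u = geodesic x u
    v⇝y : Walk (Adj G) v y (dist y v)
    v⇝y = reverse (geodesic y v)

    yv≤yu : dist y v ≤ dist y u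
    yv≤yu = ≮⇒≥ y-farther
    yu≤1+xu : dist y u ≤ suc (dist x u)
    yu≤1+xu = dist-min y u (step yx x⇝u)
    xu≤yv : dist x u ≤ dist y v
    xu≤yv = ≤-pred (≤-trans x-closer (dist-min x v (step xy (geodesic y v))))

    v⇝y-nb : NonBacktracking v⇝y
    v⇝y-nb = shortest⇒nonBacktracking v⇝y (dist-min y v ∘ reverse)
    v⇝y-not-from-x : NotEnteredFrom x v⇝y
    v⇝y-not-from-x = shortest⇒notEnteredFrom v⇝y
      (λ w → ≤-trans yv≤yu (≤-trans yu≤1+xu (≤-trans x-closer (dist-min x v (reverse w)))))
    y⇝u-nb : NonBacktracking (step yx x⇝u)
    y⇝u-nb = step-nonBacktracking yx x⇝u (shortest⇒nonBacktracking x⇝u (dist-min x u))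
      (λ w → ≤-trans xu≤yv (≤-trans yv≤yu (dist-min y u w)))
    y⇝u-not-from-v : NotEnteredFrom v (step yx x⇝u)
    y⇝u-not-from-v = step-notEnteredFrom yx x⇝u xy≢uv (λ w → <⇒≤ (<-≤-trans x-closer (dist-min x v w)))

  crossing-edge : ∀ {u v x y} → Adj G u v → Adj G x y → Closer u v x → ¬ Closer u v y → x ≡ u × y ≡ v
  crossing-edge {u} {v} {x} {y} uv xy x-closer y-farther with x Fin.≟ u | y Fin.≟ v
  ... | yes x≡u | yes y≡v = x≡u , y≡v
  ... | no x≢u | _ = contradiction (crossing-closes-cycle uv xy x-closer y-farther (λ x≡u _ → x≢u x≡u)) acyclic
  ... | yes _ | no y≢v = contradiction (crossing-closes-cycle uv xy x-closer y-farther (λ _ → y≢v)) acyclic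

-- Steiner distances across an edge of an acyclic graph

module SteinerEdge {n : ℕ} (G : Graph n) (acyclic : ¬ HasCycle G)
  (dist : Fin n → Fin n → ℕ) (dist-ok : ∀ x y → IsDist G x y (dist x y))
  (sd : Subset n → ℕ) (sd-ok : ∀ S → IsSteinerDist G S (sd S))
  {u v : Fin n} (uv : Adj G u v) where

  open Sides G acyclic dist dist-ok

  side : Subset n
  side = ⟦ closer? u v ⟧

  OnSide : Fin n × Fin n → Set
  OnSide (a , b) = Closer u v a × Closer u v b

  onSide? : Decidable OnSide
  onSide? (a , b) = closer? u v a ×-dec closer? u v b

  restrict : Subgraph G → Subgraph G
  restrict H = record
    { W = side ∩ W H
    ; F = filter onSide? (F H)
    ; F-uniq = Unique.filter⁺ onSide? (F-uniq H)
    ; F-edges = All.zipWith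
        (λ ((a-closer , b-closer) , (a<b , ab , a∈ , b∈)) →
          a<b , ab , x∈p∩q⁺ (∈⟦⟧⁺ (closer? u v) a-closer , a∈) , x∈p∩q⁺ (∈⟦⟧⁺ (closer? u v) b-closer , b∈))
        (All.all-filter onSide? (F H) , All.filter⁺ onSide? (F-edges H))
    }

  ∈restrict⁻ : ∀ H {a} → a ∈ W (restrict H) → Closer u v a × a ∈ W H
  ∈restrict⁻ H a∈ = Product.map₁ (∈⟦⟧⁻ (closer? u v)) (x∈p∩q⁻ side (W H) a∈)

  module _ (H : Subgraph G) where

    subAdj-restrict : ∀ {a b} → SubAdj H a b → Closer u v a → Closer u v b → SubAdj (restrict H) a b
    subAdj-restrict (inj₁ ab∈) a-closer b-closer = inj₁ (∈-filter⁺ onSide? ab∈ (a-closer , b-closer))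
    subAdj-restrict (inj₂ ba∈) a-closer b-closer = inj₂ (∈-filter⁺ onSide? ba∈ (b-closer , a-closer))

    restrict-shorter : SubAdj H u v → length (F (restrict H)) < length (F H)
    restrict-shorter uv∈ = filter-notAll onSide? (F H) (leaves uv∈)
      where
      leaves : SubAdj H u v → Any (¬_ ∘ OnSide) (F H)
      leaves (inj₁ uv∈) = Any.map (λ { refl (_ , v-closer) → ¬closer-other u v v-closer }) uv∈
      leaves (inj₂ vu∈) = Any.map (λ { refl (v-closer , _) → ¬closer-other u v v-closer }) vu∈

    ReachInside : Fin n → Fin n → Set
    ReachInside a b = ∃[ m ] Walk (SubAdj (restrict H)) a b m

    StaysOrCrosses : Fin n → Fin n → Set
    StaysOrCrosses a b = (Closer u v b × ReachInside a b) ⊎ (ReachInside a u × SubAdj H u v)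

    staysOrCrosses : ∀ {a b m} → Walk (SubAdj H) a b m → Closer u v a → StaysOrCrosses a b
    staysOrCrosses here a-closer = inj₁ (a-closer , 0 , here)
    staysOrCrosses (step {y = c} ac w) a-closer with closer? u v c
    ... | no c-farther with refl , refl ← crossing-edge uv (subAdj⇒adj H ac) a-closer c-farther =
      inj₂ ((0 , here) , ac)
    ... | yes c-closer with staysOrCrosses w c-closer
    ...   | inj₁ (b-closer , m , c⇝b) = inj₁ (b-closer , suc m , step (subAdj-restrict ac a-closer c-closer) c⇝b)
    ...   | inj₂ ((m , c⇝u) , uv∈) = inj₂ ((suc m , step (subAdj-restrict ac a-closer c-closer) c⇝u) , uv∈)

  restrict-connected : ∀ H → SubConnected H → SubConnected (restrict H)
  restrict-connected H H-connected a b a∈ b∈ =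
    join (staysOrCrosses H (proj₂ (H-connected a b a∈W b∈W)) a-closer)
         (staysOrCrosses H (proj₂ (H-connected b a b∈W a∈W)) b-closer)
    where
    open Walks (SubAdj (restrict H)) Sum.swap
    a-closer : Closer u v a
    a-closer = proj₁ (∈restrict⁻ H a∈)
    a∈W : a ∈ W H
    a∈W = proj₂ (∈restrict⁻ H a∈)
    b-closer : Closer u v b
    b-closer = proj₁ (∈restrict⁻ H b∈)
    b∈W : b ∈ W H
    b∈W = proj₂ (∈restrict⁻ H b∈)

    join : StaysOrCrosses H a b → StaysOrCrosses H b a → ReachInside H a b
    join (inj₁ (_ , a⇝b)) _ = a⇝b
    join (inj₂ _) (inj₁ (_ , m , b⇝a)) = m , reverse b⇝a
    join (inj₂ ((m , a⇝u) , _)) (inj₂ ((m′ , b⇝u) , _)) = m + m′ , (a⇝u ++ʷ reverse b⇝u)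

  leaving-side⇒uses-uv : ∀ H → SubConnected H → ∀ {a b} → a ∈ W H → b ∈ W H →
    Closer u v a → ¬ Closer u v b → SubAdj H u v
  leaving-side⇒uses-uv H H-connected a∈ b∈ a-closer b-farther
    with staysOrCrosses H (proj₂ (H-connected _ _ a∈ b∈)) a-closer
  ... | inj₁ (b-closer , _) = contradiction b-closer b-farther
  ... | inj₂ (_ , uv∈) = uv∈

  sd[S∪u]<sd[S∪v] : ∀ S → S ⊆ side → Nonempty S → sd (S ∪ ⁅ u ⁆) < sd (S ∪ ⁅ v ⁆)
  sd[S∪u]<sd[S∪v] S S⊆side (x , x∈S) with sd-ok (S ∪ ⁅ v ⁆) | sd-ok (S ∪ ⁅ u ⁆)
  ... | (H , H-connected , S∪v⊆W , ∣F∣≡sd) , _ | _ , sd-minimal = begin-strict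
      sd (S ∪ ⁅ u ⁆)           ≤⟨ sd-minimal (restrict H) (restrict-connected H H-connected) S∪u⊆W′ ⟩
      length (F (restrict H))  <⟨ restrict-shorter H uv∈ ⟩
      length (F H)             ≡⟨ ∣F∣≡sd ⟩
      sd (S ∪ ⁅ v ⁆)           ∎
    where
    open ≤-Reasoning
    S⊆W : S ⊆ₛ W H
    S⊆W = proj₁ (⊆ₛ-∪⁅⁆⁻ S∪v⊆W)
    uv∈ : SubAdj H u v
    uv∈ = leaving-side⇒uses-uv H H-connected (S⊆W x x∈S) (proj₂ (⊆ₛ-∪⁅⁆⁻ S∪v⊆W))
            (∈⟦⟧⁻ (closer? u v) (S⊆side x∈S)) (¬closer-other u v)
    S∪u⊆W′ : (S ∪ ⁅ u ⁆) ⊆ₛ W (restrict H)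
    S∪u⊆W′ = ⊆ₛ-∪⁅⁆ (λ y y∈S → x∈p∩q⁺ (S⊆side y∈S , S⊆W y y∈S))
                     (x∈p∩q⁺ (∈⟦⟧⁺ (closer? u v) (closer-self uv) , proj₁ (subAdj⇒∈W H uv∈)))

  sd[S∪v]≤sd[S∪u] : ∀ S {x} → x ∈ S → ¬ Closer u v x → sd (S ∪ ⁅ v ⁆) ≤ sd (S ∪ ⁅ u ⁆)
  sd[S∪v]≤sd[S∪u] S x∈S x-farther with sd-ok (S ∪ ⁅ u ⁆) | sd-ok (S ∪ ⁅ v ⁆)
  ... | (H , H-connected , S∪u⊆W , ∣F∣≡sd) , _ | _ , sd-minimal =
    subst (sd (S ∪ ⁅ v ⁆) ≤_) ∣F∣≡sd (sd-minimal H H-connected (⊆ₛ-∪⁅⁆ S⊆W (proj₂ (subAdj⇒∈W H uv∈))))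
    where
    S⊆W : S ⊆ₛ W H
    S⊆W = proj₁ (⊆ₛ-∪⁅⁆⁻ S∪u⊆W)
    uv∈ : SubAdj H u v
    uv∈ = leaving-side⇒uses-uv H H-connected (proj₂ (⊆ₛ-∪⁅⁆⁻ S∪u⊆W)) (S⊆W _ x∈S) (closer-self uv) x-farther

  sd-decreasing⇒⊆side : ∀ S → sd (S ∪ ⁅ u ⁆) < sd (S ∪ ⁅ v ⁆) → S ⊆ side
  sd-decreasing⇒⊆side S sd< {x} x∈S with closer? u v x
  ... | yes x-closer = ∈⟦⟧⁺ (closer? u v) x-closer
  ... | no x-farther = contradiction (sd[S∪v]≤sd[S∪u] S x∈S x-farther) (<⇒≱ sd<)

  nSteiner≡C : ∀ {k} → 2 ≤ k → nSteiner sd k u v ≡ (nVert dist u v ∸ 1) C (k ∸ 1)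
  nSteiner≡C {suc (suc j)} (s≤s (s≤s z≤n)) = begin
      nSteiner sd k u v
    ≡⟨ count-≐ _ (sizedSubsetOf? (side - u) (k ∸ 1)) (counted⇒sized , sized⇒counted) (allSubsets n) ⟩
      count (sizedSubsetOf? (side - u) (k ∸ 1)) (allSubsets n)
    ≡⟨ count-sizedSubsets (side - u) (k ∸ 1) ⟩
      ∣ side - u ∣ C (k ∸ 1)
    ≡⟨ cong (λ s → (s ∸ 1) C (k ∸ 1)) (trans (suc∣p-x∣≡∣p∣ u∈side) (∣⟦⟧∣≡count (closer? u v))) ⟩
      (nVert dist u v ∸ 1) C (k ∸ 1)
    ∎
    where
    open ≡-Reasoning
    k : ℕ
    k = suc (suc j)
    u∈side : u ∈ side
    u∈side = ∈⟦⟧⁺ (closer? u v) (closer-self uv)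
    counted⇒sized : ∀ {S} → u ∉ S × v ∉ S × ∣ S ∣ ≡ k ∸ 1 × sd (S ∪ ⁅ u ⁆) < sd (S ∪ ⁅ v ⁆) →
      SizedSubsetOf (side - u) (k ∸ 1) S
    counted⇒sized {S} (u∉S , _ , ∣S∣≡ , sd<) =
      (λ x∈S → x∈p∧x≢y⇒x∈p-y (sd-decreasing⇒⊆side S sd< x∈S) (λ { refl → u∉S x∈S })) , ∣S∣≡
    sized⇒counted : ∀ {S} → SizedSubsetOf (side - u) (k ∸ 1) S →
      u ∉ S × v ∉ S × ∣ S ∣ ≡ k ∸ 1 × sd (S ∪ ⁅ u ⁆) < sd (S ∪ ⁅ v ⁆)
    sized⇒counted {S} (S⊆side-u , ∣S∣≡) =
        (λ u∈S → x∈p─q⇒x∉q (S⊆side-u u∈S) (x∈⁅x⁆ u))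
      , (λ v∈S → ¬closer-other u v (∈⟦⟧⁻ (closer? u v) (p─q⊆p side ⁅ u ⁆ (S⊆side-u v∈S))))
      , ∣S∣≡
      , sd[S∪u]<sd[S∪v] S (p─q⊆p side ⁅ u ⁆ ∘ S⊆side-u) (∣p∣≡1+m⇒nonempty S ∣S∣≡)

edges-adjacent : ∀ {n} (G : Graph n) → All (λ e → Adj G (proj₁ e) (proj₂ e)) (edges G)
edges-adjacent {n} G =
  All.concat⁺ (All.map⁺ (All.tabulate⁺ {n = n} λ u → All.map⁺ (All.map proj₂ (All.all-filter _ (allFin n)))))

theorem2p1 : (n : ℕ) (T : Graph n) → IsTree T
    → (dist : Fin n → Fin n → ℕ) → (∀ x y → IsDist T x y (dist x y))
    → (sd : Subset n → ℕ) → (∀ S → IsSteinerDist T S (sd S))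
    → (k : ℕ) → 2 ≤ k → k ≤ n ∸ 1
    → SzSteiner T sd k ≡ SzFormula T dist k
theorem2p1 n T (_ , acyclic) dist dist-ok sd sd-ok k 2≤k _ =
  cong sum (map-cong-local (All.map edge-term (edges-adjacent T)))
  where
  open SteinerEdge T acyclic dist dist-ok sd sd-ok using (nSteiner≡C)
  edge-term : ∀ {u v} → Adj T u v →
      (nSteiner sd k u v + 1) * (nSteiner sd k v u + 1)
    ≡ (((nVert dist u v ∸ 1) C (k ∸ 1)) + 1) * (((nVert dist v u ∸ 1) C (k ∸ 1)) + 1)
  edge-term uv = cong₂ (λ p q → (p + 1) * (q + 1)) (nSteiner≡C uv 2≤k) (nSteiner≡C (adj-sym T uv) 2≤k)
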